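{- A tree $T$ has Edge-compelling chromatic number $3$ if and only if $T$ has radius $2$ or $T$ is a double-broom.
   Context: A proper coloring partitions the vertex set into nonempty independent color classes; a rainbow committee (RC) is a set consisting of exactly one vertex of each color. A proper coloring is Edge-compelling if every RC contains at least one pair of adjacent vertices; the Edge-compelling chromatic number is the minimum number of colors in an Edge-compelling proper coloring. A double-broom is the caterpillar obtained by taking two vertex-disjoint stars $S$ and $S'$ and joining one leaf of $S$ to one leaf of $S'$ by an edge. -}

module Defs where

open import Data.Nat using (ℕ; zero; suc; _≤_; _<_)
open import Data.Fin using (Fin; zero; suc)
open import Data.List using (List; []; _∷_; length)
open import Data.List.Relation.Unary.Unique.Propositional using (Unique)
open import Data.Sum using (_⊎_; inj₁; inj₂)
open import Data.Product using (Σ; ∃; ∃-syntax; _×_; _,_)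
open import Data.Unit using (⊤)
open import Data.Empty using (⊥)
open import Relation.Nullary using (¬_)
open import Relation.Binary.PropositionalEquality using (_≡_; _≢_)
open import Function.Bundles using (_↔_; Inverse)

record Graph : Set₁ where
  field
    V      : Set
    Adj    : V → V → Set
    sym    : ∀ {u v} → Adj u v → Adj v u
    irrefl : ∀ {v} → ¬ Adj v v
open Graph public

data Walk (G : Graph) : V G → V G → List (V G) → Set where
  here : ∀ {v} → Walk G v v (v ∷ [])
  step : ∀ {u w v vs} → Adj G u w → Walk G w v vs → Walk G u v (u ∷ vs)

-- number of edges of a walk = number of vertices - 1
walkLength : ∀ {A : Set} → List A → ℕ
walkLength []       = 0
walkLength (_ ∷ xs) = length xs

Connected : Graph → Set
Connected G = ∀ u v → ∃[ vs ] Walk G u v vs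

HasCycle : Graph → Set
HasCycle G = ∃[ u ] ∃[ v ] ∃[ vs ]
  (Walk G u v vs × Unique vs × 3 ≤ length vs × Adj G v u)

Acyclic : Graph → Set
Acyclic G = ¬ HasCycle G

IsTree : Graph → Set
IsTree G = V G × Connected G × Acyclic G

DistLE : (G : Graph) → V G → V G → ℕ → Set
DistLE G u v k = ∃[ vs ] (Walk G u v vs × walkLength vs ≤ k)

Dist : (G : Graph) → V G → V G → ℕ → Set
Dist G u v d = DistLE G u v d × (∀ k → k < d → ¬ DistLE G u v k)

Eccentricity : (G : Graph) → V G → ℕ → Set
Eccentricity G v e = (∀ u → DistLE G v u e) × ∃[ u ] Dist G v u e

Radius : Graph → ℕ → Set
Radius G r = (∃[ v ] Eccentricity G v r) × (∀ v e → Eccentricity G v e → r ≤ e)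

record ProperColoring (G : Graph) (k : ℕ) : Set where
  field
    col      : V G → Fin k
    proper   : ∀ {u v} → Adj G u v → col u ≢ col v
    nonempty : ∀ (i : Fin k) → ∃[ v ] col v ≡ i
open ProperColoring public

RainbowCommittee : (G : Graph) {k : ℕ} → ProperColoring G k → Set
RainbowCommittee G {k} c = Σ (Fin k → V G) (λ r → ∀ i → col c (r i) ≡ i)

EdgeCompelling : (G : Graph) {k : ℕ} → ProperColoring G k → Set
EdgeCompelling G {k} c =
  (rc : RainbowCommittee G c) →
    ∃[ i ] ∃[ j ] Adj G (Data.Product.proj₁ rc i) (Data.Product.proj₁ rc j)

HasECColoring : Graph → ℕ → Set
HasECColoring G k = Σ (ProperColoring G k) (EdgeCompelling G)

ECChromaticNumber : Graph → ℕ → Set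
ECChromaticNumber G k = HasECColoring G k × (∀ m → m < k → ¬ HasECColoring G m)

record _≅_ (G H : Graph) : Set where
  field
    bij      : V G ↔ V H
  open Inverse bij public
  field
    preserve : ∀ u v → Adj G u v → Adj H (to u) (to v)
    reflect  : ∀ u v → Adj H (to u) (to v) → Adj G u v

StarAdj : ∀ {m} → Fin (suc m) → Fin (suc m) → Set
StarAdj zero    zero    = ⊥
StarAdj zero    (suc _) = ⊤
StarAdj (suc _) zero    = ⊤
StarAdj (suc _) (suc _) = ⊥

IsJoinLeaf : ∀ {m} → Fin (suc (suc m)) → Set
IsJoinLeaf (suc zero) = ⊤
IsJoinLeaf _          = ⊥

-- Double-broom from stars K_{1,suc a} and K_{1,suc b}
-- (each star has at least one leaf), joining leaf suc zero of each.
DBAdj : (a b : ℕ) → Fin (suc (suc a)) ⊎ Fin (suc (suc b))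
                  → Fin (suc (suc a)) ⊎ Fin (suc (suc b)) → Set
DBAdj a b (inj₁ x) (inj₁ y) = StarAdj x y
DBAdj a b (inj₂ x) (inj₂ y) = StarAdj x y
DBAdj a b (inj₁ x) (inj₂ y) = IsJoinLeaf x × IsJoinLeaf y
DBAdj a b (inj₂ x) (inj₁ y) = IsJoinLeaf x × IsJoinLeaf y

private
  starSym : ∀ {m} {x y : Fin (suc m)} → StarAdj x y → StarAdj y x
  starSym {x = zero}  {suc _} _ = _
  starSym {x = suc _} {zero}  _ = _

  starIrr : ∀ {m} {x : Fin (suc m)} → ¬ StarAdj x x
  starIrr {x = zero} ()
  starIrr {x = suc _} ()

  dbSym : ∀ a b {u v} → DBAdj a b u v → DBAdj a b v u
  dbSym a b {inj₁ x} {inj₁ y} p = starSym p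
  dbSym a b {inj₂ x} {inj₂ y} p = starSym p
  dbSym a b {inj₁ x} {inj₂ y} (p , q) = q , p
  dbSym a b {inj₂ x} {inj₁ y} (p , q) = q , p

  dbIrr : ∀ a b {v} → ¬ DBAdj a b v v
  dbIrr a b {inj₁ x} = starIrr
  dbIrr a b {inj₂ x} = starIrr

DoubleBroomGraph : ℕ → ℕ → Graph
DoubleBroomGraph a b = record
  { V = Fin (suc (suc a)) ⊎ Fin (suc (suc b))
  ; Adj = DBAdj a b
  ; sym = λ {u} {v} → dbSym a b {u} {v}
  ; irrefl = λ {v} → dbIrr a b {v} }

IsDoubleBroom : Graph → Set
IsDoubleBroom G = ∃[ a ] ∃[ b ] (G ≅ DoubleBroomGraph a b)

-- In a tree, an edge-compelling 3-colouring admits no independent rainbow triple (it would be a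
-- rainbow committee without an edge), so every path on five vertices sees all three colours.  A
-- finite check over colour patterns then excludes a path on seven vertices, and a path p0 … p5 with
-- a third neighbour at p2.  Hence, if the tree contains a path p0 … p5, every other vertex is a leaf
-- at p1 or at p4 and the tree is a double broom; otherwise the middle vertex of a longest path is a
-- centre of eccentricity at most two.  The eccentricity is exactly two because a dominating vertex
-- would give an edge-compelling 2-colouring.  Conversely, an edge-compelling 2-colouring joins its two
-- classes completely, which in a tree forces a dominating vertex; and radius-two trees and double
-- brooms are coloured by the distance from a centre, resp. from the centres of the two stars.
module Submission where

open import Defs hiding (sym)
open import Data.Empty using (⊥; ⊥-elim)
open import Data.Fin using (Fin; zero; suc; opposite)
open import Data.Fin.Properties using (_≟_; all?; any?; 0≢1+n)
open import Data.List using (List; []; _∷_; length; drop; reverse; reverseAcc)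
open import Data.List.Membership.Propositional using (_∈_)
open import Data.List.Relation.Unary.All as All using (All; []; _∷_)
open import Data.List.Relation.Unary.All.Properties.Core using (¬Any⇒All¬)
open import Data.List.Relation.Unary.AllPairs using ([]; _∷_; allPairs?)
open import Data.List.Relation.Unary.Any as Any using (here; there)
open import Data.List.Relation.Unary.Linked as Linked using (Linked; []; [-]; _∷_)
open import Data.List.Relation.Unary.Unique.Propositional using (Unique)
import Data.List.Relation.Unary.Unique.Propositional.Properties as Unique
open import Data.Nat using (ℕ; zero; suc; _≤_; _<_; z≤n; s≤s)
open import Data.Nat.Properties using (suc-injective)
open import Data.Product using (∃; ∃-syntax; _×_; _,_; proj₁; proj₂; swap)
open import Data.Sum using (_⊎_; inj₁; inj₂; [_,_]′)
open import Data.Unit using (⊤; tt)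
open import Function.Bundles using (_⇔_; mk⇔; mk↔ₛ′)
open import Relation.Binary.PropositionalEquality
  using (_≡_; _≢_; refl; sym; trans; cong; subst; subst₂; ≢-sym)
open import Relation.Nullary using (¬_; Dec; yes; no; ¬?)
open import Relation.Nullary.Decidable
  using (_×-dec_; _⊎-dec_; _→-dec_; toWitness; decidable-stable; map′)

Colour : Set
Colour = Fin 3

_≢?_ : (a b : Colour) → Dec (a ≢ b)
a ≢? b = ¬? (a ≟ b)

Rainbow : Colour → Colour → Colour → Set
Rainbow a b c = a ≢ b × a ≢ c × b ≢ c

rainbow? : ∀ a b c → Dec (Rainbow a b c)
rainbow? a b c = a ≢? b ×-dec a ≢? c ×-dec b ≢? c

AllColours : List Colour → Set
AllColours cs = ∀ k → k ∈ cs

-- The lemmas below are finite statements about colours, checked by evaluating a decision procedure.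

rainbow-avoiding-colour : ∀ a b c k → Rainbow a b c → a ≢ k → b ≢ k → c ≡ k
rainbow-avoiding-colour = toWitness {a? = all? λ a → all? λ b → all? λ c → all? λ k →
  rainbow? a b c →-dec a ≢? k →-dec b ≢? k →-dec c ≟ k} _

two-coloured-alternates : ∀ a b c k → a ≢ k → b ≢ k → c ≢ k → a ≢ b → c ≢ b → a ≡ c
two-coloured-alternates = toWitness {a? = all? λ a → all? λ b → all? λ c → all? λ k →
  a ≢? k →-dec b ≢? k →-dec c ≢? k →-dec a ≢? b →-dec c ≢? b →-dec a ≟ c} _

seven-path-colouring-impossible : ∀ a b c d e f g →
  a ≢ b → b ≢ c → c ≢ d → d ≢ e → e ≢ f → f ≢ g → AllColours (c ∷ d ∷ e ∷ f ∷ g ∷ []) →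
  ¬ Rainbow a c f → ¬ Rainbow a c g → ¬ Rainbow a d f → ¬ Rainbow a d g →
  ¬ Rainbow b d g → ¬ Rainbow b e g → ¬ Rainbow c e g → ⊥
seven-path-colouring-impossible = toWitness {a? =
  all? λ a → all? λ b → all? λ c → all? λ d → all? λ e → all? λ f → all? λ g →
  a ≢? b →-dec b ≢? c →-dec c ≢? d →-dec d ≢? e →-dec e ≢? f →-dec f ≢? g →-dec
  all? (λ k → Any.any? (k ≟_) (c ∷ d ∷ e ∷ f ∷ g ∷ [])) →-dec
  ¬? (rainbow? a c f) →-dec ¬? (rainbow? a c g) →-dec ¬? (rainbow? a d f) →-dec ¬? (rainbow? a d g) →-dec
  ¬? (rainbow? b d g) →-dec ¬? (rainbow? b e g) →-dec ¬? (rainbow? c e g) →-dec no λ ()} _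

-- Colours of a path q0 … q5 with a pendant vertex x at q2.
spider-colouring-impossible : ∀ a b c d e f x →
  a ≢ b → b ≢ c → c ≢ d → d ≢ e → e ≢ f → c ≢ x → AllColours (f ∷ e ∷ d ∷ c ∷ x ∷ []) →
  ¬ Rainbow a c e → ¬ Rainbow a c f → ¬ Rainbow a d x → ¬ Rainbow a e x → ¬ Rainbow a f x →
  ¬ Rainbow b e x → ¬ Rainbow d f x → ⊥
spider-colouring-impossible = toWitness {a? =
  all? λ a → all? λ b → all? λ c → all? λ d → all? λ e → all? λ f → all? λ x →
  a ≢? b →-dec b ≢? c →-dec c ≢? d →-dec d ≢? e →-dec e ≢? f →-dec c ≢? x →-dec
  all? (λ k → Any.any? (k ≟_) (f ∷ e ∷ d ∷ c ∷ x ∷ [])) →-dec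
  ¬? (rainbow? a c e) →-dec ¬? (rainbow? a c f) →-dec ¬? (rainbow? a d x) →-dec ¬? (rainbow? a e x) →-dec
  ¬? (rainbow? a f x) →-dec ¬? (rainbow? b e x) →-dec ¬? (rainbow? d f x) →-dec no λ ()} _

record Enumeration {n : ℕ} (P : Fin n → Set) : Set where
  field
    size          : ℕ
    element       : Fin size → Fin n
    element-P     : ∀ j → P (element j)
    index         : ∀ i → P i → Fin size
    element-index : ∀ i p → element (index i p) ≡ i
    index-element : ∀ j p → index (element j) p ≡ j

enumerate : ∀ {n} {P : Fin n → Set} → (∀ i → Dec (P i)) → Enumeration P
enumerate {zero} P? = record
  { size = 0 ; element = λ () ; element-P = λ () ; index = λ ()
  ; element-index = λ () ; index-element = λ () }
enumerate {suc n} {P} P? with P? zero | enumerate (λ i → P? (suc i))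
... | yes p₀ | E = record
  { size          = suc E.size
  ; element       = λ { zero → zero ; (suc j) → suc (E.element j) }
  ; element-P     = λ { zero → p₀ ; (suc j) → E.element-P j }
  ; index         = λ { zero _ → zero ; (suc i) p → suc (E.index i p) }
  ; element-index = λ { zero _ → refl ; (suc i) p → cong suc (E.element-index i p) }
  ; index-element = λ { zero _ → refl ; (suc j) p → cong suc (E.index-element j p) } }
  where module E = Enumeration E
... | no ¬p₀ | E = record
  { size          = E.size
  ; element       = λ j → suc (E.element j)
  ; element-P     = E.element-P
  ; index         = λ { zero p → ⊥-elim (¬p₀ p) ; (suc i) p → E.index i p }
  ; element-index = λ { zero p → ⊥-elim (¬p₀ p) ; (suc i) p → cong suc (E.element-index i p) }
  ; index-element = E.index-element }
  where module E = Enumeration E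

any-list? : ∀ {n} k {P : List (Fin n) → Set} → (∀ vs → Dec (P vs)) →
            Dec (∃ λ vs → length vs ≡ k × P vs)
any-list? zero    P? = map′ (λ p → [] , refl , p) (λ { ([] , refl , p) → p }) (P? [])
any-list? (suc k) P? =
  map′ (λ (x , vs , eq , p) → x ∷ vs , cong suc eq , p)
       (λ { ([] , () , _) ; (x ∷ vs , eq , p) → x , vs , suc-injective eq , p })
       (any? λ x → any-list? k (λ vs → P? (x ∷ vs)))

Dominating : (G : Graph) → V G → Set
Dominating G x = ∀ w → w ≢ x → Adj G x w

module _ {G H : Graph} (G≅H : G ≅ H) where
  open _≅_ G≅H

  ≅-transports-EC : ∀ {k} → HasECColoring H k → HasECColoring G k
  ≅-transports-EC (c , ec) = colouring , compelling
    where
    colouring : ProperColoring G _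
    colouring = record
      { col      = λ u → col c (to u)
      ; proper   = λ {u} {v} a → proper c (preserve u v a)
      ; nonempty = λ i → let y , cy = nonempty c i in
                         from y , trans (cong (col c) (strictlyInverseˡ y)) cy }
    compelling : EdgeCompelling G colouring
    compelling (r , rainbow) = let i , j , a = ec ((λ i → to (r i)) , rainbow) in i , j , reflect _ _ a

  ≅-reflects-¬dominating : (∀ y → ¬ Dominating H y) → ∀ x → ¬ Dominating G x
  ≅-reflects-¬dominating ¬dom x dom = ¬dom (to x) λ y y≢tox →
    subst (Adj H (to x)) (strictlyInverseˡ y)
          (preserve x (from y) (dom (from y) λ { refl → y≢tox (sym (strictlyInverseˡ y)) }))

broom-colour : ∀ {a b} → V (DoubleBroomGraph a b) → Fin 3
broom-colour (inj₁ zero)    = zero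
broom-colour (inj₁ (suc _)) = suc zero
broom-colour (inj₂ zero)    = zero
broom-colour (inj₂ (suc _)) = suc (suc zero)

broom-EC₃ : ∀ a b → HasECColoring (DoubleBroomGraph a b) 3
broom-EC₃ a b = colouring , compelling
  where
  proper′ : ∀ {y y′} → DBAdj a b y y′ → broom-colour y ≢ broom-colour y′
  proper′ {inj₁ zero}       {inj₁ (suc _)}    _ ()
  proper′ {inj₁ (suc _)}    {inj₁ zero}       _ ()
  proper′ {inj₂ zero}       {inj₂ (suc _)}    _ ()
  proper′ {inj₂ (suc _)}    {inj₂ zero}       _ ()
  proper′ {inj₁ (suc zero)} {inj₂ (suc zero)} _ ()
  proper′ {inj₂ (suc zero)} {inj₁ (suc zero)} _ ()
  colouring : ProperColoring (DoubleBroomGraph a b) 3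
  colouring = record
    { col      = broom-colour
    ; proper   = proper′
    ; nonempty = λ { zero → inj₁ zero , refl ; (suc zero) → inj₁ (suc zero) , refl
                   ; (suc (suc zero)) → inj₂ (suc zero) , refl } }
  centre-adjacent : ∀ y₀ y₁ y₂ → broom-colour y₀ ≡ zero → broom-colour y₁ ≡ suc zero →
                    broom-colour y₂ ≡ suc (suc zero) → DBAdj a b y₀ y₁ ⊎ DBAdj a b y₀ y₂
  centre-adjacent (inj₁ zero) (inj₁ (suc _)) _ _ _ _ = inj₁ tt
  centre-adjacent (inj₂ zero) _ (inj₂ (suc _)) _ _ _ = inj₂ tt
  centre-adjacent (inj₁ zero) (inj₂ zero)    _ _ () _
  centre-adjacent (inj₁ zero) (inj₂ (suc _)) _ _ () _
  centre-adjacent (inj₂ zero) _ (inj₁ zero)    _ _ ()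
  centre-adjacent (inj₂ zero) _ (inj₁ (suc _)) _ _ ()
  compelling : EdgeCompelling (DoubleBroomGraph a b) colouring
  compelling (r , rainbow)
    with centre-adjacent (r zero) (r (suc zero)) (r (suc (suc zero)))
                         (rainbow zero) (rainbow (suc zero)) (rainbow (suc (suc zero)))
  ... | inj₁ adj = zero , suc zero , adj
  ... | inj₂ adj = zero , suc (suc zero) , adj

broom-¬dominating : ∀ a b y → ¬ Dominating (DoubleBroomGraph a b) y
broom-¬dominating a b (inj₁ x) dom = proj₂ (dom (inj₂ zero) (λ ()))
broom-¬dominating a b (inj₂ y) dom = proj₂ (dom (inj₁ zero) (λ ()))

module FinGraph {n : ℕ} (A : Fin n → Fin n → Set)
                (A-sym : ∀ {u v} → A u v → A v u) (A-irrefl : ∀ {v} → ¬ A v v) where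

  G : Graph
  G = record { V = Fin n ; Adj = A ; sym = A-sym ; irrefl = A-irrefl }

  adj⇒≢ : ∀ {u v} → A u v → u ≢ v
  adj⇒≢ a refl = A-irrefl a

  Path : List (Fin n) → Set
  Path vs = Linked A vs × Unique vs

  edge-path : ∀ {x y} → A x y → Path (x ∷ y ∷ [])
  edge-path a = a ∷ [-] , (adj⇒≢ a ∷ []) ∷ [] ∷ []

  path-tail : ∀ {x xs} → Path (x ∷ xs) → Path xs
  path-tail (L , _ ∷ U) = Linked.tail L , U

  path-drop : ∀ k {xs} → Path xs → Path (drop k xs)
  path-drop k (L , U) = linked-drop k L , Unique.drop⁺ k U
    where
    linked-drop : ∀ k {xs} → Linked A xs → Linked A (drop k xs)
    linked-drop zero    L = L
    linked-drop (suc k) {[]}    L = L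
    linked-drop (suc k) {_ ∷ _} L = linked-drop k (Linked.tail L)

  -- reverse is defined by reverseAcc, so both halves are proved for an accumulator.
  path-reverse : ∀ {xs} → Path xs → Path (reverse xs)
  path-reverse {[]}     _       = [] , []
  path-reverse {x ∷ xs} (L , U) =
    linked-reverse [-] L , unique-reverse [] (x ∷ xs) [] U (All.universal (λ _ → []) _)
    where
    linked-reverse : ∀ {x acc xs} → Linked A (x ∷ acc) → Linked A (x ∷ xs) →
                     Linked A (reverseAcc (x ∷ acc) xs)
    linked-reverse acc [-]      = acc
    linked-reverse acc (a ∷ xs) = linked-reverse (A-sym a ∷ acc) xs
    unique-reverse : ∀ acc xs → Unique acc → Unique xs → All (λ y → All (y ≢_) acc) xs →
                     Unique (reverseAcc acc xs)
    unique-reverse acc []       Uacc _          _            = Uacc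
    unique-reverse acc (y ∷ ys) Uacc (y≢ys ∷ U) (y≢acc ∷ ys≢acc) =
      unique-reverse (y ∷ acc) ys (y≢acc ∷ Uacc) U
        (All.map (λ { (y≢z , z≢acc) → ≢-sym y≢z ∷ z≢acc }) (All.zip (y≢ys , ys≢acc)))

  module Tree (connected : Connected G) (acyclic : Acyclic G) where

    -- `apart` carries the path walked back from the current vertex to x, which an edge from x to
    -- the next vertex would close into a cycle.
    head-apart : ∀ {x y zs} → Path (x ∷ y ∷ zs) → All (λ z → ¬ A x z) zs
    head-apart {x} {y} (a ∷ L , (x≢y ∷ x≢zs) ∷ y≢zs ∷ U) =
      apart (step (A-sym a) here) ((≢-sym x≢y ∷ []) ∷ [] ∷ []) L U
            (All.map (λ { (y≢z , x≢z) → ≢-sym y≢z ∷ ≢-sym x≢z ∷ [] }) (All.zip (y≢zs , x≢zs)))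
      where
      apart : ∀ {v p ps zs} → Walk G v x (v ∷ p ∷ ps) → Unique (v ∷ p ∷ ps) → Linked A (v ∷ zs) →
              Unique zs → All (λ z → All (z ≢_) (v ∷ p ∷ ps)) zs → All (λ z → ¬ A x z) zs
      apart w Uw [-]     []            []           = []
      apart w Uw (b ∷ L) (u≢zs ∷ Uzs) (u≢ws ∷ zs≢ws) =
        (λ axu → acyclic (_ , _ , _ , walk , Uwalk , s≤s (s≤s (s≤s z≤n)) , axu)) ∷
        apart walk Uwalk L Uzs (All.map (λ { (u≢z , z≢ws) → ≢-sym u≢z ∷ z≢ws }) (All.zip (u≢zs , zs≢ws)))
        where
        walk = step (A-sym b) w
        Uwalk = u≢ws ∷ Uw

    path-extend : ∀ {x y z zs} → A x y → Path (y ∷ z ∷ zs) → x ≢ z → Path (x ∷ y ∷ z ∷ zs)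
    path-extend {y = y} a P@(L , U) x≢z =
      a ∷ L , (adj⇒≢ a ∷ x≢z ∷ All.map (λ ¬ayw x≡w → ¬ayw (subst (A y) x≡w (A-sym a))) (head-apart P)) ∷ U

    Induced : List (Fin n) → Set
    Induced []           = ⊤
    Induced (x ∷ [])     = ⊤
    Induced (x ∷ y ∷ zs) = All (λ z → ¬ A x z) zs × Induced (y ∷ zs)

    path-induced : ∀ {vs} → Path vs → Induced vs
    path-induced {[]}         _ = tt
    path-induced {x ∷ []}     _ = tt
    path-induced {x ∷ y ∷ zs} P = head-apart P , path-induced (path-tail P)

    walk-source-∈ : ∀ {u v vs} → Walk G u v vs → u ∈ vs
    walk-source-∈ here       = here refl
    walk-source-∈ (step _ _) = here refl

    walk-suffix : ∀ {x v u ws} → Walk G x v ws → Unique ws → u ∈ ws →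
                  ∃ λ us → Walk G u v us × Unique us
    walk-suffix here         U       (here refl) = _ , here , U
    walk-suffix w@(step _ _) U       (here refl) = _ , w , U
    walk-suffix (step _ w) (_ ∷ U) (there u∈) = walk-suffix w U u∈

    simple-walk : ∀ {u v vs} → Walk G u v vs → ∃ λ ws → Walk G u v ws × Unique ws
    simple-walk here = _ , here , [] ∷ []
    simple-walk {u} (step a w) with simple-walk w
    ... | ws , w′ , U with Any.any? (u ≟_) ws
    ...   | yes u∈ = walk-suffix w′ U u∈
    ...   | no  u∉ = u ∷ ws , step a w′ , ¬Any⇒All¬ ws u∉ ∷ U

    -- An edge u–v parallel to a simple walk of length at least two would close a cycle.
    adjacent? : ∀ u v → Dec (A u v)
    adjacent? u v with simple-walk (proj₂ (connected u v))
    ... | _ , here , _                  = no A-irrefl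
    ... | _ , step a here , _           = yes a
    ... | _ , w@(step _ (step _ w′)) , U =
      no λ a → acyclic (u , v , _ , w , U , s≤s (s≤s (walk-nonempty w′)) , A-sym a)
      where
      walk-nonempty : ∀ {x y vs} → Walk G x y vs → 1 ≤ length vs
      walk-nonempty here       = s≤s z≤n
      walk-nonempty (step _ _) = s≤s z≤n

    ¬A-sym : ∀ {u v} → ¬ A u v → ¬ A v u
    ¬A-sym ¬a a = ¬a (A-sym a)

    dist≤0 : ∀ {u v} → DistLE G u v 0 → u ≡ v
    dist≤0 (_ , here , _)               = refl
    dist≤0 (_ , step _ here , ())
    dist≤0 (_ , step _ (step _ _) , ())

    dist≤1 : ∀ {u v} → DistLE G u v 1 → u ≡ v ⊎ A u v
    dist≤1 (_ , here , _)                    = inj₁ refl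
    dist≤1 (_ , step a here , _)             = inj₂ a
    dist≤1 (_ , step _ (step _ here) , s≤s ())
    dist≤1 (_ , step _ (step _ (step _ _)) , s≤s ())

    dist≤2 : ∀ {u v} → DistLE G u v 2 → u ≡ v ⊎ A u v ⊎ ∃[ x ] (A u x × A x v)
    dist≤2 (_ , here , _)                  = inj₁ refl
    dist≤2 (_ , step a here , _)           = inj₂ (inj₁ a)
    dist≤2 (_ , step a (step b here) , _)  = inj₂ (inj₂ (_ , a , b))
    dist≤2 (_ , step _ (step _ (step _ here)) , s≤s (s≤s ()))
    dist≤2 (_ , step _ (step _ (step _ (step _ _))) , s≤s (s≤s ()))

    dist-refl : ∀ {u k} → DistLE G u u k
    dist-refl = _ , here , z≤n

    dist-edge : ∀ {u v k} → A u v → DistLE G u v (suc k)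
    dist-edge a = _ , step a here , s≤s z≤n

    dist-two : ∀ {u x v k} → A u x → A x v → DistLE G u v (suc (suc k))
    dist-two a b = _ , step a (step b here) , s≤s (s≤s z≤n)

    near-or-far : ∀ c w → DistLE G c w 2 ⊎ ∃[ x1 ] ∃[ x2 ] ∃[ x3 ] Path (c ∷ x1 ∷ x2 ∷ x3 ∷ [])
    near-or-far c w with simple-walk (proj₂ (connected c w))
    ... | _ , here , _                                = inj₁ dist-refl
    ... | _ , step a here , _                         = inj₁ (dist-edge a)
    ... | _ , step a (step b here) , _                = inj₁ (dist-two a b)
    ... | _ , step a (step b (step d here)) , U       = inj₂ (_ , _ , _ , a ∷ b ∷ d ∷ [-] , U)
    ... | _ , step a (step b (step d (step _ _))) , U = inj₂ (_ , _ , _ , a ∷ b ∷ d ∷ [-] , Unique.take⁺ 4 U)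

    HasPath : ℕ → Set
    HasPath k = ∃ λ vs → length vs ≡ k × Path vs

    hasPath? : ∀ k → Dec (HasPath k)
    hasPath? k = any-list? k λ vs → Linked.linked? adjacent? vs ×-dec allPairs? (λ x y → ¬? (x ≟ y)) vs

    splice : ∀ {a b c x xs} → Path (a ∷ b ∷ c ∷ []) → Path (c ∷ x ∷ xs) → x ≢ b → Path (a ∷ b ∷ c ∷ x ∷ xs)
    splice (ab ∷ bc ∷ [-] , (_ ∷ a≢c ∷ []) ∷ _) F x≢b = path-extend ab (path-extend bc F (≢-sym x≢b)) a≢c

    centre-of-path₅ : ∀ {p0 p1 p2 p3 p4} → Path (p0 ∷ p1 ∷ p2 ∷ p3 ∷ p4 ∷ []) → ¬ HasPath 6 →
                      ∀ w → DistLE G p2 w 2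
    centre-of-path₅ {p1 = p1} P@(_ , _ ∷ (_ ∷ p1≢p3 ∷ _) ∷ _) ¬P6 w with near-or-far _ w
    ... | inj₁ d = d
    ... | inj₂ (x1 , _ , _ , F) with x1 ≟ p1
    ...   | yes refl = ⊥-elim (¬P6 (_ , refl , splice (path-reverse (path-drop 2 P)) F p1≢p3))
    ...   | no x1≢p1 = ⊥-elim (¬P6 (_ , refl , splice (path-reverse (path-drop 2 (path-reverse P))) F x1≢p1))

    centre-of-path₄ : ∀ {p0 p1 p2 p3} → Path (p0 ∷ p1 ∷ p2 ∷ p3 ∷ []) → ¬ HasPath 5 →
                      ∀ w → DistLE G p1 w 2
    centre-of-path₄ {p0 = p0} P@(a01 ∷ a12 ∷ _ ∷ [-] , (_ ∷ p0≢p2 ∷ _) ∷ _) ¬P5 w with near-or-far _ w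
    ... | inj₁ d = d
    ... | inj₂ (x1 , _ , _ , F) with x1 ≟ p0
    ...   | yes refl = ⊥-elim (¬P5 (_ , refl , path-extend (A-sym a12) F (≢-sym p0≢p2)))
    ...   | no x1≢p0 = ⊥-elim (¬P5 (_ , refl , path-extend a01 F (≢-sym x1≢p0)))

    centre-without-path₄ : ¬ HasPath 4 → ∀ c w → DistLE G c w 2
    centre-without-path₄ ¬P4 c w with near-or-far c w
    ... | inj₁ d                 = d
    ... | inj₂ (_ , _ , _ , F) = ⊥-elim (¬P4 (_ , refl , F))

    -- A longest path has at most five vertices, and its middle vertex is then a centre.
    centre : ¬ HasPath 6 → Fin n → ∃[ c ] (∀ w → DistLE G c w 2)
    centre ¬P6 v with hasPath? 5 | hasPath? 4
    ... | yes ((_ ∷ _ ∷ p2 ∷ _ ∷ _ ∷ []) , refl , P) | _ = p2 , centre-of-path₅ P ¬P6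
    ... | no ¬P5 | yes ((_ ∷ p1 ∷ _ ∷ _ ∷ []) , refl , P) = p1 , centre-of-path₄ P ¬P5
    ... | no _   | no ¬P4 = v , centre-without-path₄ ¬P4 v

    undominated-vertex : ∀ x → ¬ Dominating G x → ∃[ w ] (w ≢ x × ¬ A x w)
    undominated-vertex x ¬dom with any? (λ w → ¬? (w ≟ x) ×-dec ¬? (adjacent? x w))
    ... | yes found = found
    ... | no none   = ⊥-elim (¬dom λ w w≢x → decidable-stable (adjacent? x w) (λ ¬a → none (w , w≢x , ¬a)))

    another-vertex : ∀ {u v : Fin n} → u ≢ v → ∀ x → ∃[ w ] w ≢ x
    another-vertex {u} {v} u≢v x with x ≟ v
    ... | yes refl = u , u≢v
    ... | no x≢v   = v , ≢-sym x≢v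

    radius-two : ∃[ c ] (∀ w → DistLE G c w 2) → (∀ x → ¬ Dominating G x) → Radius G 2
    radius-two (c , near) ¬dom = (c , near , u , near u , nearer-fails) , at-least-two
      where
      u = proj₁ (undominated-vertex c (¬dom c))
      u≢c = proj₁ (proj₂ (undominated-vertex c (¬dom c)))
      ¬cu = proj₂ (proj₂ (undominated-vertex c (¬dom c)))
      nearer-fails : ∀ k → k < 2 → ¬ DistLE G c u k
      nearer-fails zero       _ d = u≢c (sym (dist≤0 d))
      nearer-fails (suc zero) _ d = [ (λ e → u≢c (sym e)) , ¬cu ]′ (dist≤1 d)
      nearer-fails (suc (suc _)) (s≤s (s≤s ()))
      at-least-two : ∀ v e → Eccentricity G v e → 2 ≤ e
      at-least-two v zero       (reach , _) =
        ⊥-elim (¬dom v λ w w≢v → ⊥-elim (w≢v (sym (dist≤0 (reach w)))))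
      at-least-two v (suc zero) (reach , _) =
        ⊥-elim (¬dom v λ w w≢v → [ (λ e → ⊥-elim (w≢v (sym e))) , (λ a → a) ]′ (dist≤1 (reach w)))
      at-least-two v (suc (suc e)) _ = s≤s (s≤s z≤n)

    dominating⇒eccentricity-one : ∀ {x w} → Dominating G x → w ≢ x → Eccentricity G x 1
    dominating⇒eccentricity-one {x} {w} dom w≢x =
      reach , w , dist-edge (dom w w≢x) , λ { zero _ d → w≢x (sym (dist≤0 d)) ; (suc _) (s≤s ()) }
      where
      reach : ∀ y → DistLE G x y 1
      reach y with y ≟ x
      ... | yes refl = dist-refl
      ... | no y≢x   = dist-edge (dom y y≢x)

    radius-two⇒¬dominating : Radius G 2 → ∀ x → ¬ Dominating G x
    radius-two⇒¬dominating ((v , _ , u , _ , nearer-fails) , at-least) x dom =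
      let w , w≢x = another-vertex u≢v x in 2≰1 (at-least x 1 (dominating⇒eccentricity-one dom w≢x))
      where
      u≢v : u ≢ v
      u≢v refl = nearer-fails 0 (s≤s z≤n) dist-refl
      2≰1 : ¬ 2 ≤ 1
      2≰1 (s≤s ())

    module ColourClasses {k} (colour : Fin n → Fin k) (InClass : Fin k → Fin n → Set)
                         (in-class : ∀ u → InClass (colour u) u) where

      class-of : ∀ {u} i → colour u ≡ i → InClass i u
      class-of {u} i e = subst (λ j → InClass j u) e (in-class u)

      proper-if-classes-independent : (∀ i {u v} → InClass i u → InClass i v → ¬ A u v) →
                                      ∀ {u v} → A u v → colour u ≢ colour v
      proper-if-classes-independent independent {u} {v} a e =
        independent (colour u) (in-class u) (class-of (colour u) (sym e)) a

    dominating⇒EC₂ : ∀ {x w} → Dominating G x → w ≢ x → HasECColoring G 2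
    dominating⇒EC₂ {x} {w} dom w≢x = colouring , compelling
      where
      colour : Fin n → Fin 2
      colour u with u ≟ x
      ... | yes _ = zero
      ... | no _  = suc zero
      InClass : Fin 2 → Fin n → Set
      InClass zero       u = u ≡ x
      InClass (suc zero) u = u ≢ x
      in-class : ∀ u → InClass (colour u) u
      in-class u with u ≟ x
      ... | yes e   = e
      ... | no u≢x  = u≢x
      open ColourClasses colour InClass in-class
      independent : ∀ i {u v} → InClass i u → InClass i v → ¬ A u v
      independent zero       refl refl = A-irrefl
      independent (suc zero) u≢x  v≢x  a =
        All.head (head-apart (path-extend (A-sym (dom _ u≢x)) (edge-path (dom _ v≢x)) (adj⇒≢ a))) a
      colour-x : colour x ≡ zero
      colour-x with x ≟ x
      ... | yes _   = refl
      ... | no x≢x  = ⊥-elim (x≢x refl)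
      colour-w : colour w ≡ suc zero
      colour-w with w ≟ x
      ... | yes e   = ⊥-elim (w≢x e)
      ... | no _    = refl
      inhabited : ∀ i → ∃[ u ] colour u ≡ i
      inhabited zero       = x , colour-x
      inhabited (suc zero) = w , colour-w
      colouring : ProperColoring G 2
      colouring = record
        { col = colour ; proper = proper-if-classes-independent independent ; nonempty = inhabited }
      compelling : EdgeCompelling G colouring
      compelling (r , rainbow) with class-of zero (rainbow zero) | class-of (suc zero) (rainbow (suc zero))
      ... | refl | r₁≢x = zero , suc zero , dom _ r₁≢x

    -- In an edge-compelling 2-colouring every vertex of one class is adjacent to every vertex of the
    -- other; if both classes had two vertices they would span a 4-cycle.
    EC₂⇒dominating : HasECColoring G 2 → ∃[ x ] Dominating G x
    EC₂⇒dominating (c , ec) = by-second-vertices (another-in-class zero u₀) (another-in-class (suc zero) v₀)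
      where
      κ = col c
      joined : ∀ {u v} → κ u ≡ zero → κ v ≡ suc zero → A u v
      joined {u} {v} κu κv with ec ((λ { zero → u ; (suc zero) → v }) , λ { zero → κu ; (suc zero) → κv })
      ... | zero     , zero     , a = ⊥-elim (A-irrefl a)
      ... | zero     , suc zero , a = a
      ... | suc zero , zero     , a = A-sym a
      ... | suc zero , suc zero , a = ⊥-elim (A-irrefl a)
      u₀ = proj₁ (nonempty c zero)
      v₀ = proj₁ (nonempty c (suc zero))
      κu₀ = proj₂ (nonempty c zero)
      κv₀ = proj₂ (nonempty c (suc zero))
      another-in-class : ∀ i u → Dec (∃[ w ] (w ≢ u × κ w ≡ i))
      another-in-class i u = any? λ w → ¬? (w ≟ u) ×-dec κ w ≟ i
      other-class : ∀ {w} i → κ w ≢ i → κ w ≡ opposite i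
      other-class {w} zero       κw≢0 with κ w
      ... | zero     = ⊥-elim (κw≢0 refl)
      ... | suc zero = refl
      other-class {w} (suc zero) κw≢1 with κ w
      ... | zero     = refl
      ... | suc zero = ⊥-elim (κw≢1 refl)
      by-second-vertices : Dec (∃[ w ] (w ≢ u₀ × κ w ≡ zero)) → Dec (∃[ w ] (w ≢ v₀ × κ w ≡ suc zero)) →
                           ∃[ x ] Dominating G x
      by-second-vertices (no none) _ =
        u₀ , λ w w≢u₀ → joined κu₀ (other-class zero (λ κw → none (w , w≢u₀ , κw)))
      by-second-vertices (yes _) (no none) =
        v₀ , λ w w≢v₀ → A-sym (joined (other-class (suc zero) (λ κw → none (w , w≢v₀ , κw))) κv₀)
      by-second-vertices (yes (u₁ , u₁≢u₀ , κu₁)) (yes (v₁ , v₁≢v₀ , κv₁)) =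
        ⊥-elim (All.head (All.tail (head-apart four-path)) (joined κu₀ κv₁))
        where
        four-path : Path (u₀ ∷ v₀ ∷ u₁ ∷ v₁ ∷ [])
        four-path = path-extend (joined κu₀ κv₀)
                      (path-extend (A-sym (joined κu₁ κv₀)) (edge-path (joined κu₁ κv₁)) (≢-sym v₁≢v₀))
                      (≢-sym u₁≢u₀)

    no-EC-colouring-below-three : Fin n → (∀ x → ¬ Dominating G x) → ∀ m → m < 3 → ¬ HasECColoring G m
    no-EC-colouring-below-three v _    zero             _ (c , _)  with col c v
    ... | ()
    no-EC-colouring-below-three v _    (suc zero)       _ (c , ec) with col c v in κv
    ... | zero = A-irrefl (proj₂ (proj₂ (ec ((λ _ → v) , λ { zero → κv }))))
    no-EC-colouring-below-three v ¬dom (suc (suc zero)) _ EC₂ =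
      let x , dom = EC₂⇒dominating EC₂ in ¬dom x dom
    no-EC-colouring-below-three v _    (suc (suc (suc _))) (s≤s (s≤s (s≤s ())))

    module DistanceColouring {c} (near : ∀ w → DistLE G c w 2) where

      colour : Fin n → Fin 3
      colour w with w ≟ c | adjacent? c w
      ... | yes _ | _     = zero
      ... | no _  | yes _ = suc zero
      ... | no _  | no _  = suc (suc zero)

      InClass : Fin 3 → Fin n → Set
      InClass zero             w = w ≡ c
      InClass (suc zero)       w = A c w
      InClass (suc (suc zero)) w = w ≢ c × ¬ A c w

      in-class : ∀ w → InClass (colour w) w
      in-class w with w ≟ c | adjacent? c w
      ... | yes e   | _     = e
      ... | no _    | yes a = a
      ... | no w≢c  | no ¬a = w≢c , ¬a

      open ColourClasses colour InClass in-class public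

      middle : ∀ {w} → w ≢ c → ¬ A c w → ∃[ x ] (A c x × A x w)
      middle {w} w≢c ¬a with dist≤2 (near w)
      ... | inj₁ c≡w      = ⊥-elim (w≢c (sym c≡w))
      ... | inj₂ (inj₁ a) = ⊥-elim (¬a a)
      ... | inj₂ (inj₂ m) = m

      classes-independent : ∀ i {v w} → InClass i v → InClass i w → ¬ A v w
      classes-independent zero             refl refl = A-irrefl
      classes-independent (suc zero)       acv  acw  a =
        All.head (head-apart (path-extend (A-sym acv) (edge-path acw) (adj⇒≢ a))) a
      classes-independent (suc (suc zero)) {v} {w} (v≢c , ¬cv) (w≢c , ¬cw) a
        with middle v≢c ¬cv | middle w≢c ¬cw
      ... | x , acx , axv | y , acy , ayw with x ≟ y
      ...   | yes refl = All.head (head-apart (path-extend (A-sym axv) (edge-path ayw) (adj⇒≢ a))) a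
      ...   | no x≢y   = All.head (All.tail (All.tail (head-apart five-path))) a
        where
        five-path : Path (v ∷ x ∷ c ∷ y ∷ w ∷ [])
        five-path = path-extend (A-sym axv)
                      (path-extend (A-sym acx) (path-extend acy (edge-path ayw) (≢-sym w≢c)) x≢y) v≢c

      colour-centre : colour c ≡ zero
      colour-centre with c ≟ c
      ... | yes _  = refl
      ... | no c≢c = ⊥-elim (c≢c refl)

      colour-neighbour : ∀ {w} → A c w → colour w ≡ suc zero
      colour-neighbour {w} a with w ≟ c | adjacent? c w
      ... | yes refl | _     = ⊥-elim (A-irrefl a)
      ... | no _     | yes _ = refl
      ... | no _     | no ¬a = ⊥-elim (¬a a)

      colour-far : ∀ {w} → w ≢ c → ¬ A c w → colour w ≡ suc (suc zero)
      colour-far {w} w≢c ¬a with w ≟ c | adjacent? c w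
      ... | yes e | _     = ⊥-elim (w≢c e)
      ... | no _  | yes a = ⊥-elim (¬a a)
      ... | no _  | no _  = refl

    radius-two⇒EC₃ : Radius G 2 → HasECColoring G 3
    radius-two⇒EC₃ ((c , near , u , _ , nearer-fails) , _) = colouring , compelling
      where
      open DistanceColouring near
      u≢c : u ≢ c
      u≢c refl = nearer-fails 0 (s≤s z≤n) dist-refl
      ¬cu : ¬ A c u
      ¬cu a = nearer-fails 1 (s≤s (s≤s z≤n)) (dist-edge a)
      inhabited : ∀ i → ∃[ w ] colour w ≡ i
      inhabited zero             = c , colour-centre
      inhabited (suc zero)       = let x , acx , _ = middle u≢c ¬cu in x , colour-neighbour acx
      inhabited (suc (suc zero)) = u , colour-far u≢c ¬cu
      colouring : ProperColoring G 3
      colouring = record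
        { col = colour ; proper = proper-if-classes-independent classes-independent ; nonempty = inhabited }
      compelling : EdgeCompelling G colouring
      compelling (r , rainbow) with class-of zero (rainbow zero)
      ... | refl = zero , suc zero , class-of (suc zero) (rainbow (suc zero))

    module EdgeCompellingColouring (c : ProperColoring G 3) (ec : EdgeCompelling G c) where

      κ : Fin n → Colour
      κ = col c

      no-independent-rainbow-triple : ∀ {x y z} → Rainbow (κ x) (κ y) (κ z) →
                                      ¬ A x y → ¬ A x z → ¬ A y z → ⊥
      no-independent-rainbow-triple {x} {y} {z} rb ¬xy ¬xz ¬yz =
        let i , j , a = ec (committee , committee-rainbow) in independent (among i) (among j) a
        where
        committee : Fin 3 → Fin n
        committee i with κ x ≟ i | κ y ≟ i
        ... | yes _ | _     = x
        ... | no _  | yes _ = y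
        ... | no _  | no _  = z
        committee-rainbow : ∀ i → κ (committee i) ≡ i
        committee-rainbow i with κ x ≟ i | κ y ≟ i
        ... | yes e | _     = e
        ... | no _  | yes e = e
        ... | no ¬x | no ¬y = rainbow-avoiding-colour _ _ _ i rb ¬x ¬y
        Triple : Fin n → Set
        Triple u = u ≡ x ⊎ u ≡ y ⊎ u ≡ z
        among : ∀ i → Triple (committee i)
        among i with κ x ≟ i | κ y ≟ i
        ... | yes _ | _     = inj₁ refl
        ... | no _  | yes _ = inj₂ (inj₁ refl)
        ... | no _  | no _  = inj₂ (inj₂ refl)
        independent : ∀ {u v} → Triple u → Triple v → ¬ A u v
        independent (inj₁ refl)        (inj₁ refl)        = A-irrefl
        independent (inj₁ refl)        (inj₂ (inj₁ refl)) = ¬xy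
        independent (inj₁ refl)        (inj₂ (inj₂ refl)) = ¬xz
        independent (inj₂ (inj₁ refl)) (inj₁ refl)        = ¬A-sym ¬xy
        independent (inj₂ (inj₁ refl)) (inj₂ (inj₁ refl)) = A-irrefl
        independent (inj₂ (inj₁ refl)) (inj₂ (inj₂ refl)) = ¬yz
        independent (inj₂ (inj₂ refl)) (inj₁ refl)        = ¬A-sym ¬xz
        independent (inj₂ (inj₂ refl)) (inj₂ (inj₁ refl)) = ¬A-sym ¬yz
        independent (inj₂ (inj₂ refl)) (inj₂ (inj₂ refl)) = A-irrefl

      independent⇒¬rainbow : ∀ {x y z} → ¬ A x y → ¬ A x z → ¬ A y z → ¬ Rainbow (κ x) (κ y) (κ z)
      independent⇒¬rainbow ¬xy ¬xz ¬yz rb = no-independent-rainbow-triple rb ¬xy ¬xz ¬yz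

      -- A path on five vertices avoiding a colour k alternates between two colours a b a b a, and a
      -- vertex z of colour k forms an independent rainbow triple with q1, q4 or with q0, q3.
      path₅-missing-colour : ∀ {q0 q1 q2 q3 q4 k} → Path (q0 ∷ q1 ∷ q2 ∷ q3 ∷ q4 ∷ []) →
                             ¬ All (k ≢_) (κ q0 ∷ κ q1 ∷ κ q2 ∷ κ q3 ∷ κ q4 ∷ [])
      path₅-missing-colour {q0} {q1} {q2} {q3} {q4} {k} P@(a01 ∷ a12 ∷ a23 ∷ a34 ∷ [-] , _)
                           (k≢0 ∷ k≢1 ∷ k≢2 ∷ k≢3 ∷ k≢4 ∷ []) with path-induced P
      ... | (_ ∷ ¬03 ∷ _ ∷ []) , (_ ∷ ¬14 ∷ []) , _ = by-neighbours (adjacent? z q0) (adjacent? z q3)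
        where
        z : Fin n
        z = proj₁ (nonempty c k)
        κz≡k : κ z ≡ k
        κz≡k = proj₂ (nonempty c k)
        z≢ : ∀ {q} → k ≢ κ q → z ≢ q
        z≢ k≢q refl = k≢q (sym κz≡k)
        κz≢ : ∀ {q} → k ≢ κ q → κ z ≢ κ q
        κz≢ k≢q e = k≢q (trans (sym κz≡k) e)
        κ0≡κ2 : κ q0 ≡ κ q2
        κ0≡κ2 = two-coloured-alternates _ _ _ k (≢-sym k≢0) (≢-sym k≢1) (≢-sym k≢2)
                  (proper c a01) (λ e → proper c a12 (sym e))
        κ2≡κ4 : κ q2 ≡ κ q4
        κ2≡κ4 = two-coloured-alternates _ _ _ k (≢-sym k≢2) (≢-sym k≢3) (≢-sym k≢4)
                  (proper c a23) (λ e → proper c a34 (sym e))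
        rainbow-z14 : Rainbow (κ z) (κ q1) (κ q4)
        rainbow-z14 = κz≢ k≢1 , κz≢ k≢4 , λ e → proper c a12 (trans e (sym κ2≡κ4))
        rainbow-z03 : Rainbow (κ z) (κ q0) (κ q3)
        rainbow-z03 = κz≢ k≢0 , κz≢ k≢3 , λ e → proper c a23 (trans (sym κ0≡κ2) e)
        by-neighbours : Dec (A z q0) → Dec (A z q3) → ⊥
        by-neighbours (yes a) _ with head-apart (path-extend a P (z≢ k≢1))
        ... | ¬z1 ∷ _ ∷ _ ∷ ¬z4 ∷ [] = no-independent-rainbow-triple rainbow-z14 ¬z1 ¬z4 ¬14
        by-neighbours (no ¬z0) (yes a)
          with head-apart (path-extend a (path-drop 1 (path-reverse P)) (z≢ k≢2))
             | head-apart (path-extend a (path-drop 3 P) (z≢ k≢4))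
        ... | _ ∷ ¬z1 ∷ _ ∷ [] | ¬z4 ∷ [] = no-independent-rainbow-triple rainbow-z14 ¬z1 ¬z4 ¬14
        by-neighbours (no ¬z0) (no ¬z3) = no-independent-rainbow-triple rainbow-z03 ¬z0 ¬z3 ¬03

      path₅-all-colours : ∀ {q0 q1 q2 q3 q4} → Path (q0 ∷ q1 ∷ q2 ∷ q3 ∷ q4 ∷ []) →
                          AllColours (κ q0 ∷ κ q1 ∷ κ q2 ∷ κ q3 ∷ κ q4 ∷ [])
      path₅-all-colours P k =
        decidable-stable (Any.any? (k ≟_) _) (λ k∉ → path₅-missing-colour P (¬Any⇒All¬ _ k∉))

      no-path₇ : ∀ {q0 q1 q2 q3 q4 q5 q6} → ¬ Path (q0 ∷ q1 ∷ q2 ∷ q3 ∷ q4 ∷ q5 ∷ q6 ∷ [])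
      no-path₇ P@(a01 ∷ a12 ∷ a23 ∷ a34 ∷ a45 ∷ a56 ∷ [-] , _) with path-induced P
      ... | (¬02 ∷ ¬03 ∷ _ ∷ ¬05 ∷ ¬06 ∷ []) , (¬13 ∷ ¬14 ∷ _ ∷ ¬16 ∷ []) , (¬24 ∷ ¬25 ∷ ¬26 ∷ [])
          , (¬35 ∷ ¬36 ∷ []) , (¬46 ∷ []) , _ =
        seven-path-colouring-impossible _ _ _ _ _ _ _
          (proper c a01) (proper c a12) (proper c a23) (proper c a34) (proper c a45) (proper c a56)
          (path₅-all-colours (path-drop 2 P))
          (independent⇒¬rainbow ¬02 ¬05 ¬25) (independent⇒¬rainbow ¬02 ¬06 ¬26)
          (independent⇒¬rainbow ¬03 ¬05 ¬35) (independent⇒¬rainbow ¬03 ¬06 ¬36)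
          (independent⇒¬rainbow ¬13 ¬16 ¬36) (independent⇒¬rainbow ¬14 ¬16 ¬46)
          (independent⇒¬rainbow ¬24 ¬26 ¬46)

      no-spider : ∀ {q0 q1 q2 q3 q4 q5 x} → Path (q0 ∷ q1 ∷ q2 ∷ q3 ∷ q4 ∷ q5 ∷ []) →
                  A q2 x → x ≢ q1 → x ≢ q3 → ⊥
      no-spider P@(a01 ∷ a12 ∷ a23 ∷ a34 ∷ a45 ∷ [-] , _) a x≢q1 x≢q3
        with path-extend (A-sym a) (path-drop 2 P) x≢q3
           | path-extend (A-sym a) (path-drop 3 (path-reverse P)) x≢q1
      ... | leg-right | leg-left with path-induced P | head-apart leg-right | head-apart leg-left
      ... | (¬02 ∷ ¬03 ∷ ¬04 ∷ ¬05 ∷ []) , (_ ∷ ¬14 ∷ _ ∷ []) , (¬24 ∷ ¬25 ∷ []) , (¬35 ∷ []) , _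
          | ¬x3 ∷ ¬x4 ∷ ¬x5 ∷ [] | ¬x1 ∷ ¬x0 ∷ [] =
        spider-colouring-impossible _ _ _ _ _ _ _
          (proper c a01) (proper c a12) (proper c a23) (proper c a34) (proper c a45) (proper c a)
          (path₅-all-colours (path-reverse leg-right))
          (independent⇒¬rainbow ¬02 ¬04 ¬24) (independent⇒¬rainbow ¬02 ¬05 ¬25)
          (independent⇒¬rainbow ¬03 (¬A-sym ¬x0) (¬A-sym ¬x3))
          (independent⇒¬rainbow ¬04 (¬A-sym ¬x0) (¬A-sym ¬x4))
          (independent⇒¬rainbow ¬05 (¬A-sym ¬x0) (¬A-sym ¬x5))
          (independent⇒¬rainbow ¬14 (¬A-sym ¬x1) (¬A-sym ¬x4))
          (independent⇒¬rainbow ¬35 (¬A-sym ¬x3) (¬A-sym ¬x5))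

      module SixPath {q0 q1 q2 q3 q4 q5} (P : Path (q0 ∷ q1 ∷ q2 ∷ q3 ∷ q4 ∷ q5 ∷ [])) where

        private
          a12 : A q1 q2
          a12 = Linked.head (Linked.tail (proj₁ P))

        q1≢q2 : q1 ≢ q2
        q1≢q2 = adj⇒≢ a12

        q2-neighbour : ∀ {x} → A q2 x → x ≡ q1 ⊎ x ≡ q3
        q2-neighbour {x} a with x ≟ q1 | x ≟ q3
        ... | yes e   | _       = inj₁ e
        ... | no _    | yes e   = inj₂ e
        ... | no x≢q1 | no x≢q3 = ⊥-elim (no-spider P a x≢q1 x≢q3)

        Leaf : Fin n → Set
        Leaf w = A q1 w × w ≢ q2

        leaf? : ∀ w → Dec (Leaf w)
        leaf? w = adjacent? q1 w ×-dec ¬? (w ≟ q2)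

        leaf≢q1 : ∀ {w} → Leaf w → w ≢ q1
        leaf≢q1 (a , _) = ≢-sym (adj⇒≢ a)

        -- A second neighbour z of a leaf w would give the seven-vertex path z w q1 … q5.
        leaf-neighbour : ∀ {w z} → Leaf w → A w z → z ≡ q1
        leaf-neighbour {w} {z} (a , w≢q2) b with z ≟ q1
        ... | yes e   = e
        ... | no z≢q1 =
          ⊥-elim (no-path₇ (path-extend (A-sym b) (path-extend (A-sym a) (path-tail P) w≢q2) z≢q1))

        simple-walk-from-q1 : ∀ {w ws} → Walk G q1 w ws → Unique (q2 ∷ ws) → w ≢ q1 → A q1 w
        simple-walk-from-q1 here                 _ w≢q1 = ⊥-elim (w≢q1 refl)
        simple-walk-from-q1 (step a here)        _ _    = a
        simple-walk-from-q1 (step a (step b W)) ((_ ∷ q2≢x ∷ _) ∷ (_ ∷ q1∉) ∷ _) _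
          with leaf-neighbour (a , ≢-sym q2≢x) b
        ... | refl = ⊥-elim (All.lookup q1∉ (walk-source-∈ W) refl)

        module Leaves = Enumeration (enumerate leaf?)

        Star : Set
        Star = Fin (suc (suc Leaves.size))

        -- Numbered as a star of DoubleBroomGraph: centre, join leaf, then the other leaves.
        vertex : Star → Fin n
        vertex zero          = q1
        vertex (suc zero)    = q2
        vertex (suc (suc j)) = Leaves.element j

        Half : Fin n → Set
        Half w = w ≡ q1 ⊎ w ≡ q2 ⊎ Leaf w

        half? : ∀ w → Dec (Half w)
        half? w = w ≟ q1 ⊎-dec w ≟ q2 ⊎-dec leaf? w

        vertex-half : ∀ x → Half (vertex x)
        vertex-half zero          = inj₁ refl
        vertex-half (suc zero)    = inj₂ (inj₁ refl)
        vertex-half (suc (suc j)) = inj₂ (inj₂ (Leaves.element-P j))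

        index : ∀ {w} → Half w → Star
        index (inj₁ _)         = zero
        index (inj₂ (inj₁ _))  = suc zero
        index (inj₂ (inj₂ l))  = suc (suc (Leaves.index _ l))

        vertex-index : ∀ {w} (h : Half w) → vertex (index h) ≡ w
        vertex-index (inj₁ refl)        = refl
        vertex-index (inj₂ (inj₁ refl)) = refl
        vertex-index (inj₂ (inj₂ l))    = Leaves.element-index _ l

        index-vertex : ∀ x (h : Half (vertex x)) → index h ≡ x
        index-vertex zero          (inj₁ _)         = refl
        index-vertex zero          (inj₂ (inj₁ e))  = ⊥-elim (q1≢q2 e)
        index-vertex zero          (inj₂ (inj₂ l))  = ⊥-elim (leaf≢q1 l refl)
        index-vertex (suc zero)    (inj₁ e)         = ⊥-elim (q1≢q2 (sym e))
        index-vertex (suc zero)    (inj₂ (inj₁ _))  = refl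
        index-vertex (suc zero)    (inj₂ (inj₂ l))  = ⊥-elim (proj₂ l refl)
        index-vertex (suc (suc j)) (inj₁ e)         = ⊥-elim (leaf≢q1 (Leaves.element-P j) e)
        index-vertex (suc (suc j)) (inj₂ (inj₁ e))  = ⊥-elim (proj₂ (Leaves.element-P j) e)
        index-vertex (suc (suc j)) (inj₂ (inj₂ l))  = cong (λ i → suc (suc i)) (Leaves.index-element j l)

        star⇒adjacent : ∀ x y → StarAdj x y → A (vertex x) (vertex y)
        star⇒adjacent zero          (suc zero)    _ = a12
        star⇒adjacent zero          (suc (suc j)) _ = proj₁ (Leaves.element-P j)
        star⇒adjacent (suc zero)    zero          _ = A-sym a12
        star⇒adjacent (suc (suc i)) zero          _ = A-sym (proj₁ (Leaves.element-P i))

        adjacent⇒star : ∀ x y → A (vertex x) (vertex y) → StarAdj x y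
        adjacent⇒star zero          zero          a = A-irrefl a
        adjacent⇒star zero          (suc _)       _ = _
        adjacent⇒star (suc _)       zero          _ = _
        adjacent⇒star (suc zero)    (suc zero)    a = A-irrefl a
        adjacent⇒star (suc zero)    (suc (suc j)) a =
          q1≢q2 (sym (leaf-neighbour (Leaves.element-P j) (A-sym a)))
        adjacent⇒star (suc (suc i)) (suc zero)    a = q1≢q2 (sym (leaf-neighbour (Leaves.element-P i) a))
        adjacent⇒star (suc (suc i)) (suc (suc j)) a =
          leaf≢q1 (Leaves.element-P j) (leaf-neighbour (Leaves.element-P i) a)

      module DoubleBroom {p0 p1 p2 p3 p4 p5} (P : Path (p0 ∷ p1 ∷ p2 ∷ p3 ∷ p4 ∷ p5 ∷ [])) where
        module L = SixPath P
        module R = SixPath (path-reverse P)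

        private
          a23 : A p2 p3
          a23 = Linked.head (Linked.tail (Linked.tail (proj₁ P)))
          distinct = proj₂ P
          induced = path-induced P

        p1≢p3 : p1 ≢ p3
        p1≢p3 with distinct
        ... | _ ∷ (_ ∷ p1≢p3 ∷ _) ∷ _ = p1≢p3

        p1≢p4 : p1 ≢ p4
        p1≢p4 with distinct
        ... | _ ∷ (_ ∷ _ ∷ p1≢p4 ∷ _) ∷ _ = p1≢p4

        p2≢p4 : p2 ≢ p4
        p2≢p4 with distinct
        ... | _ ∷ _ ∷ (_ ∷ p2≢p4 ∷ _) ∷ _ = p2≢p4

        ¬A-p1-p3 : ¬ A p1 p3
        ¬A-p1-p3 with induced
        ... | _ , (¬13 ∷ _) , _ = ¬13

        ¬A-p1-p4 : ¬ A p1 p4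
        ¬A-p1-p4 with induced
        ... | _ , (_ ∷ ¬14 ∷ _) , _ = ¬14

        ¬A-p2-p4 : ¬ A p2 p4
        ¬A-p2-p4 with induced
        ... | _ , _ , (¬24 ∷ _) , _ = ¬24

        outside⇒leaf : ∀ w → w ≢ p1 → w ≢ p2 → w ≢ p3 → w ≢ p4 → A p1 w ⊎ A p4 w
        outside⇒leaf w w≢p1 w≢p2 w≢p3 w≢p4 with simple-walk (proj₂ (connected p2 w))
        ... | _ , here , _ = ⊥-elim (w≢p2 refl)
        ... | _ , step a W , U with L.q2-neighbour a
        ...   | inj₁ refl = inj₁ (L.simple-walk-from-q1 W U w≢p1)
        ...   | inj₂ refl with W | U
        ...     | here         | _ = ⊥-elim (w≢p3 refl)
        ...     | step b W′    | (_ ∷ p2∉) ∷ U′ with R.q2-neighbour b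
        ...       | inj₁ refl = inj₂ (R.simple-walk-from-q1 W′ U′ w≢p4)
        ...       | inj₂ refl = ⊥-elim (All.lookup p2∉ (walk-source-∈ W′) refl)

        halves-disjoint : ∀ {w} → L.Half w → R.Half w → ⊥
        halves-disjoint (inj₁ refl)        (inj₁ e)              = p1≢p4 e
        halves-disjoint (inj₁ refl)        (inj₂ (inj₁ e))       = p1≢p3 e
        halves-disjoint (inj₁ refl)        (inj₂ (inj₂ (a , _))) = ¬A-p1-p4 (A-sym a)
        halves-disjoint (inj₂ (inj₁ refl)) (inj₁ e)              = p2≢p4 e
        halves-disjoint (inj₂ (inj₁ refl)) (inj₂ (inj₁ e))       = adj⇒≢ a23 e
        halves-disjoint (inj₂ (inj₁ refl)) (inj₂ (inj₂ (a , _))) = ¬A-p2-p4 (A-sym a)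
        halves-disjoint (inj₂ (inj₂ (a , _))) (inj₁ refl)        = ¬A-p1-p4 a
        halves-disjoint (inj₂ (inj₂ (a , _))) (inj₂ (inj₁ refl)) = ¬A-p1-p3 a
        halves-disjoint (inj₂ (inj₂ l))    (inj₂ (inj₂ (a , _))) = p1≢p4 (sym (L.leaf-neighbour l (A-sym a)))

        cross-adjacent : ∀ x y → A (L.vertex x) (R.vertex y) → IsJoinLeaf x × IsJoinLeaf y
        cross-adjacent zero          zero          a = ⊥-elim (¬A-p1-p4 a)
        cross-adjacent zero          (suc zero)    a = ⊥-elim (¬A-p1-p3 a)
        cross-adjacent zero          (suc (suc j)) a =
          ⊥-elim (p1≢p4 (R.leaf-neighbour (R.Leaves.element-P j) (A-sym a)))
        cross-adjacent (suc zero)    zero          a = ⊥-elim (¬A-p2-p4 a)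
        cross-adjacent (suc zero)    (suc zero)    _ = _
        cross-adjacent (suc zero)    (suc (suc j)) a =
          ⊥-elim (p2≢p4 (R.leaf-neighbour (R.Leaves.element-P j) (A-sym a)))
        cross-adjacent (suc (suc i)) zero          a =
          ⊥-elim (p1≢p4 (sym (L.leaf-neighbour (L.Leaves.element-P i) a)))
        cross-adjacent (suc (suc i)) (suc zero)    a =
          ⊥-elim (p1≢p3 (sym (L.leaf-neighbour (L.Leaves.element-P i) a)))
        cross-adjacent (suc (suc i)) (suc (suc j)) a =
          ⊥-elim (¬A-p1-p4 (A-sym (subst (A p4) (L.leaf-neighbour (L.Leaves.element-P i) a)
                                                  (proj₁ (R.Leaves.element-P j)))))

        join-adjacent : ∀ x y → IsJoinLeaf x → IsJoinLeaf y → A (L.vertex x) (R.vertex y)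
        join-adjacent (suc zero) (suc zero) _ _ = a23

        Broom : Graph
        Broom = DoubleBroomGraph L.Leaves.size R.Leaves.size

        from : V Broom → Fin n
        from (inj₁ x) = L.vertex x
        from (inj₂ y) = R.vertex y

        other-half : ∀ w → ¬ L.Half w → R.Half w
        other-half w ¬h with w ≟ p4 | w ≟ p3
        ... | yes e   | _       = inj₁ e
        ... | no _    | yes e   = inj₂ (inj₁ e)
        ... | no w≢p4 | no w≢p3 =
          [ (λ a → ⊥-elim (¬h (inj₂ (inj₂ (a , w≢p2))))) , (λ a → inj₂ (inj₂ (a , w≢p3))) ]′
            (outside⇒leaf w (λ e → ¬h (inj₁ e)) w≢p2 w≢p3 w≢p4)
          where
          w≢p2 : w ≢ p2
          w≢p2 e = ¬h (inj₂ (inj₁ e))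

        to : Fin n → V Broom
        to w with L.half? w
        ... | yes h = inj₁ (L.index h)
        ... | no ¬h = inj₂ (R.index (other-half w ¬h))

        from-to : ∀ w → from (to w) ≡ w
        from-to w with L.half? w
        ... | yes h = L.vertex-index h
        ... | no ¬h = R.vertex-index (other-half w ¬h)

        to-from : ∀ y → to (from y) ≡ y
        to-from (inj₁ x) with L.half? (L.vertex x)
        ... | yes h = cong inj₁ (L.index-vertex x h)
        ... | no ¬h = ⊥-elim (¬h (L.vertex-half x))
        to-from (inj₂ y) with L.half? (R.vertex y)
        ... | yes h = ⊥-elim (halves-disjoint h (R.vertex-half y))
        ... | no ¬h = cong inj₂ (R.index-vertex y _)

        broom⇒adjacent : ∀ y y′ → DBAdj _ _ y y′ → A (from y) (from y′)
        broom⇒adjacent (inj₁ x) (inj₁ x′) = L.star⇒adjacent x x′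
        broom⇒adjacent (inj₂ y) (inj₂ y′) = R.star⇒adjacent y y′
        broom⇒adjacent (inj₁ x) (inj₂ y) (jx , jy) = join-adjacent x y jx jy
        broom⇒adjacent (inj₂ y) (inj₁ x) (jy , jx) = A-sym (join-adjacent x y jx jy)

        adjacent⇒broom : ∀ y y′ → A (from y) (from y′) → DBAdj _ _ y y′
        adjacent⇒broom (inj₁ x) (inj₁ x′) = L.adjacent⇒star x x′
        adjacent⇒broom (inj₂ y) (inj₂ y′) = R.adjacent⇒star y y′
        adjacent⇒broom (inj₁ x) (inj₂ y)  = cross-adjacent x y
        adjacent⇒broom (inj₂ y) (inj₁ x) a = swap (cross-adjacent x y (A-sym a))

        isomorphism : G ≅ Broom
        isomorphism = record
          { bij      = mk↔ₛ′ to from to-from from-to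
          ; preserve = λ u v a →
              adjacent⇒broom (to u) (to v) (subst₂ A (sym (from-to u)) (sym (from-to v)) a)
          ; reflect  = λ u v b → subst₂ A (from-to u) (from-to v) (broom⇒adjacent (to u) (to v) b) }

    radius-two⇒ECχ₃ : Radius G 2 → ECChromaticNumber G 3
    radius-two⇒ECχ₃ R@((c , _) , _) =
      radius-two⇒EC₃ R , no-EC-colouring-below-three c (radius-two⇒¬dominating R)

    double-broom⇒ECχ₃ : Fin n → IsDoubleBroom G → ECChromaticNumber G 3
    double-broom⇒ECχ₃ v (a , b , G≅broom) =
      ≅-transports-EC G≅broom (broom-EC₃ a b) ,
      no-EC-colouring-below-three v (≅-reflects-¬dominating G≅broom (broom-¬dominating a b))

    ECχ₃⇒radius-two-or-double-broom : ECChromaticNumber G 3 → Radius G 2 ⊎ IsDoubleBroom G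
    ECχ₃⇒radius-two-or-double-broom ((c , ec) , minimal) with hasPath? 6
    ... | yes ((_ ∷ _ ∷ _ ∷ _ ∷ _ ∷ _ ∷ []) , refl , P) =
      inj₂ (_ , _ , EdgeCompellingColouring.DoubleBroom.isomorphism c ec P)
    ... | no ¬P6 = inj₁ (radius-two (centre ¬P6 v₀) ¬dominating)
      where
      v₀ = proj₁ (nonempty c zero)
      v₁ = proj₁ (nonempty c (suc zero))
      v₁≢v₀ : v₁ ≢ v₀
      v₁≢v₀ e = 0≢1+n (trans (sym (proj₂ (nonempty c zero)))
                             (trans (cong (col c) (sym e)) (proj₂ (nonempty c (suc zero)))))
      ¬dominating : ∀ x → ¬ Dominating G x
      ¬dominating x dom = let w , w≢x = another-vertex v₁≢v₀ x in
        minimal 2 (s≤s (s≤s (s≤s z≤n))) (dominating⇒EC₂ dom w≢x)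

mainTheorem8 : (T : Graph) → (n : ℕ) → V T ≡ Fin n → IsTree T →
    ECChromaticNumber T 3 ⇔ (Radius T 2 ⊎ IsDoubleBroom T)
mainTheorem8 record { Adj = A ; sym = A-sym ; irrefl = A-irrefl } n refl (v , connected , acyclic) =
  mk⇔ ECχ₃⇒radius-two-or-double-broom [ radius-two⇒ECχ₃ , double-broom⇒ECχ₃ v ]′
  where open FinGraph.Tree A A-sym A-irrefl connected acyclic
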